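{- Let $n\ge1$, let $v=(v_1,\ldots,v_n)$ and $p=(p_1,\ldots,p_n)$ be two $0$-$1$ vectors having the same number of zeros, and let $\mu=(\mu_1,\ldots,\mu_n)$ be a vector of nonnegative integers. Then there is a unique permutation $\sigma\in\mathfrak{S}_n$ with $v=\mathbf{val}(\sigma)$, $p=\mathbf{pos}(\sigma)$ and $\mu=\mathbf{nes}(\sigma)$ if and only if for each $k\in[n]$, $$0\le\mu_k\le\#\{\ell: v_\ell=0,\ \ell\le k\}-\#\{\ell: p_\ell=0,\ \ell<k\}-1 .$$
   Context: $\mathfrak{S}_n$ is the set of permutations of $[n]=\{1,\ldots,n\}$. For $\sigma\in\mathfrak{S}_n$, $\mathbf{val}(\sigma)=(v_1,\ldots,v_n)$ with $v_i=1$ if $i>\sigma^{ -1}(i)$ and $v_i=0$ otherwise; $\mathbf{pos}(\sigma)=(p_1,\ldots,p_n)$ with $p_i=1$ if $\sigma(i)>i$ and $p_i=0$ otherwise; $\mathbf{nes}(\sigma)=(\mathrm{nest}_1(\sigma),\ldots,\mathrm{nest}_n(\sigma))$, where for $k\in[n]$ the nesting index is $$\mathrm{nest}_k(\sigma)=\#\{\ell:\ \ell<\sigma(k)\le k<\sigma^{ -1}(\ell)\ \text{ or }\ \ell<k<\sigma(k)<\sigma(\ell)\}.$$ -}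

module Defs where

open import Data.Nat using (ℕ; zero; suc; _+_)
open import Data.Bool using (Bool; true; false; if_then_else_)
import Data.Bool as B
open import Data.Fin using (Fin; zero; suc; _<_; _≤_)
open import Data.Fin.Properties using (_<?_; _≤?_)
open import Data.Fin.Permutation using (Permutation′; _⟨$⟩ʳ_; _⟨$⟩ˡ_)
open import Data.Product using (_×_; Σ; _,_)
open import Data.Sum using (_⊎_)
open import Relation.Nullary using (Dec; yes; no)
open import Relation.Nullary.Decidable using (⌊_⌋; _×-dec_; _⊎-dec_)
open import Relation.Unary using (Decidable)
open import Relation.Binary.PropositionalEquality using (_≡_)
open import Function using (_∘_)

-- Conventions: [n] = {1,…,n} is represented by Fin n (element i ↔ i+1;
-- order is preserved). A permutation σ ∈ 𝔖_n is a Permutation′ n;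
-- σ(i) = σ ⟨$⟩ʳ i and σ⁻¹(i) = σ ⟨$⟩ˡ i.
-- A 0-1 vector is a function Fin n → Bool with true ↔ 1, false ↔ 0.

count : ∀ {n} (P : Fin n → Set) → Decidable P → ℕ
count {zero} P d = 0
count {suc n} P d = (if ⌊ d zero ⌋ then 1 else 0) + count (P ∘ suc) (d ∘ suc)

val : ∀ {n} → Permutation′ n → Fin n → Bool
val σ i = ⌊ (σ ⟨$⟩ˡ i) <? i ⌋

pos : ∀ {n} → Permutation′ n → Fin n → Bool
pos σ i = ⌊ i <? (σ ⟨$⟩ʳ i) ⌋

NestCond : ∀ {n} → Permutation′ n → Fin n → Fin n → Set
NestCond σ k ℓ =
  (ℓ < σ ⟨$⟩ʳ k × σ ⟨$⟩ʳ k ≤ k × k < σ ⟨$⟩ˡ ℓ)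
  ⊎ (ℓ < k × k < σ ⟨$⟩ʳ k × σ ⟨$⟩ʳ k < σ ⟨$⟩ʳ ℓ)

nestCond? : ∀ {n} (σ : Permutation′ n) (k : Fin n) → Decidable (NestCond σ k)
nestCond? σ k ℓ =
  (ℓ <? σ ⟨$⟩ʳ k ×-dec σ ⟨$⟩ʳ k ≤? k ×-dec k <? σ ⟨$⟩ˡ ℓ)
  ⊎-dec (ℓ <? k ×-dec k <? σ ⟨$⟩ʳ k ×-dec σ ⟨$⟩ʳ k <? σ ⟨$⟩ʳ ℓ)

nest : ∀ {n} → Permutation′ n → Fin n → ℕ
nest σ k = count (NestCond σ k) (nestCond? σ k)

zeros : ∀ {n} → (Fin n → Bool) → ℕ
zeros v = count (λ ℓ → v ℓ ≡ false) (λ ℓ → v ℓ B.≟ false)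

zerosUpTo : ∀ {n} → (Fin n → Bool) → Fin n → ℕ
zerosUpTo v k = count (λ ℓ → v ℓ ≡ false × ℓ ≤ k) (λ ℓ → (v ℓ B.≟ false) ×-dec (ℓ ≤? k))

zerosBefore : ∀ {n} → (Fin n → Bool) → Fin n → ℕ
zerosBefore p k = count (λ ℓ → p ℓ ≡ false × ℓ < k) (λ ℓ → (p ℓ B.≟ false) ×-dec (ℓ <? k))

Realises : ∀ {n} → (Fin n → Bool) → (Fin n → Bool) → (Fin n → ℕ) → Permutation′ n → Set
Realises v p μ σ = (∀ i → val σ i ≡ v i) × (∀ i → pos σ i ≡ p i) × (∀ i → nest σ i ≡ μ i)

UniqueRealising : ∀ {n} → (Fin n → Bool) → (Fin n → Bool) → (Fin n → ℕ) → Set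
UniqueRealising {n} v p μ =
  Σ (Permutation′ n) λ σ → Realises v p μ σ ×
    ((τ : Permutation′ n) → Realises v p μ τ → ∀ i → τ ⟨$⟩ʳ i ≡ σ ⟨$⟩ʳ i)

module Submission where

-- Call k an excedance of σ when k < σ k (pos = 1); val σ ℓ = 0 means σ⁻¹ ℓ ≥ ℓ.
--   * Necessity (nest-bound): at a non-excedance k, the non-excedances before k, k
--     itself and the positions nesting k all reach values ≤ k; at an excedance the
--     same count follows by balancing the positions that cross the cut after k.
--   * Uniqueness (realisation-unique): at a first disagreement σ k < τ k the nesting
--     indices at k differ; non-excedances are settled left to right, then the rest
--     right to left.
--   * Existence (Existence): a greedy matching with prescribed ranks (GreedyMatching)
--     sends excedances to values above them with v = 1 and, read backwards, the
--     non-excedances to values below them with v = 0; the bound is exactly the room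
--     each greedy choice needs.

-- The development lives in its own module so that _<_ and _≤_ can denote the order
-- on Fin; the statement of lemma6 uses _≤_ for the order on ℤ.
module ValPosNes where

  open import Defs
  open import Data.Nat as ℕ using (ℕ; zero; suc; _+_; z≤n; s≤s)
  import Data.Nat.Properties as ℕₚ
  open import Data.Nat.Tactic.RingSolver using (solve-∀)
  open import Data.Bool as Bool using (Bool; true; false; if_then_else_)
  open import Data.Bool.Properties using (not-¬)
  open import Data.Unit using (⊤; tt)
  open import Data.Fin using (Fin; zero; suc; toℕ; fromℕ<; opposite; _<_; _≤_)
  import Data.Fin.Properties as Finₚ
  open import Data.Fin.Properties using (any?; _≟_; _<?_; _≤?_)
  open import Data.Fin.Induction using (<-wellFounded; >-wellFounded)
  open import Data.Fin.Permutation using (Permutation′; _⟨$⟩ʳ_; _⟨$⟩ˡ_; inverseˡ; inverseʳ; permutation)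
  open import Data.Product using (_×_; Σ; ∃; _,_; proj₁; proj₂)
  open import Data.Sum using (_⊎_; inj₁; inj₂)
  open import Data.Empty using (⊥; ⊥-elim)
  open import Induction.WellFounded using (module All)
  open import Relation.Nullary using (Dec; yes; no; ¬_)
  open import Relation.Nullary.Decidable using (⌊_⌋; _×-dec_; _⊎-dec_; ¬?)
  open import Relation.Unary using (Decidable)
  open import Relation.Binary using (Tri; tri<; tri≈; tri>)
  open import Relation.Binary.PropositionalEquality
  open import Function using (_∘_; const)
  open import Data.Vec.Functional using (updateAt)
  open import Data.Vec.Functional.Properties using (updateAt-updates; updateAt-minimal)

  count-ext : ∀ {n} {P Q : Fin n → Set} (dP : Decidable P) (dQ : Decidable Q) →
    (∀ x → P x → Q x) → (∀ x → Q x → P x) → count P dP ≡ count Q dQ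
  count-ext {zero} _ _ _ _ = refl
  count-ext {suc n} dP dQ f g with dP zero | dQ zero
  ... | yes _ | yes _ = cong suc (count-ext (dP ∘ suc) (dQ ∘ suc) (f ∘ suc) (g ∘ suc))
  ... | no _  | no _  = count-ext (dP ∘ suc) (dQ ∘ suc) (f ∘ suc) (g ∘ suc)
  ... | yes p | no ¬q = ⊥-elim (¬q (f zero p))
  ... | no ¬p | yes q = ⊥-elim (¬p (g zero q))

  count-mono : ∀ {n} {P Q : Fin n → Set} (dP : Decidable P) (dQ : Decidable Q) →
    (∀ x → P x → Q x) → count P dP ℕ.≤ count Q dQ
  count-mono {zero} _ _ _ = z≤n
  count-mono {suc n} dP dQ f with dP zero | dQ zero
  ... | yes _ | yes _ = s≤s (count-mono (dP ∘ suc) (dQ ∘ suc) (f ∘ suc))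
  ... | no _  | no _  = count-mono (dP ∘ suc) (dQ ∘ suc) (f ∘ suc)
  ... | yes p | no ¬q = ⊥-elim (¬q (f zero p))
  ... | no _  | yes _ = ℕₚ.m≤n⇒m≤1+n (count-mono (dP ∘ suc) (dQ ∘ suc) (f ∘ suc))

  count-strict : ∀ {n} {P Q : Fin n → Set} (dP : Decidable P) (dQ : Decidable Q) →
    (∀ x → P x → Q x) → (a : Fin n) → Q a → ¬ P a → count P dP ℕ.< count Q dQ
  count-strict {suc n} dP dQ f zero qa ¬pa with dP zero | dQ zero
  ... | yes p | _     = ⊥-elim (¬pa p)
  ... | no _  | no ¬q = ⊥-elim (¬q qa)
  ... | no _  | yes _ = s≤s (count-mono (dP ∘ suc) (dQ ∘ suc) (f ∘ suc))
  count-strict {suc n} dP dQ f (suc a) qa ¬pa with dP zero | dQ zero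
     | count-strict (dP ∘ suc) (dQ ∘ suc) (f ∘ suc) a qa ¬pa
  ... | yes _ | yes _ | ih = s≤s ih
  ... | no _  | no _  | ih = ih
  ... | yes p | no ¬q | _  = ⊥-elim (¬q (f zero p))
  ... | no _  | yes _ | ih = ℕₚ.m≤n⇒m≤1+n ih

  count-⊎ : ∀ {n} {P Q : Fin n → Set} (dP : Decidable P) (dQ : Decidable Q) →
    (∀ x → P x → Q x → ⊥) →
    count (λ x → P x ⊎ Q x) (λ x → dP x ⊎-dec dQ x) ≡ count P dP + count Q dQ
  count-⊎ {zero} _ _ _ = refl
  count-⊎ {suc n} dP dQ disj with dP zero | dQ zero | count-⊎ (dP ∘ suc) (dQ ∘ suc) (disj ∘ suc)
  ... | yes p | yes q | _  = ⊥-elim (disj zero p q)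
  ... | yes _ | no _  | ih = cong suc ih
  ... | no _  | yes _ | ih = trans (cong suc ih) (sym (ℕₚ.+-suc _ _))
  ... | no _  | no _  | ih = ih

  count-union : ∀ {n} {P Q R : Fin n → Set} (dP : Decidable P) (dQ : Decidable Q) (dR : Decidable R) →
    (∀ x → P x → Q x → ⊥) → (∀ x → R x → P x ⊎ Q x) → (∀ x → P x ⊎ Q x → R x) →
    count R dR ≡ count P dP + count Q dQ
  count-union dP dQ dR disj split join =
    trans (count-ext dR (λ x → dP x ⊎-dec dQ x) split join) (count-⊎ dP dQ disj)

  count-empty : ∀ {n} {P : Fin n → Set} (dP : Decidable P) → (∀ x → ¬ P x) → count P dP ≡ 0
  count-empty {zero} _ _ = refl
  count-empty {suc n} dP ¬P with dP zero
  ... | yes p = ⊥-elim (¬P zero p)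
  ... | no _  = count-empty (dP ∘ suc) (¬P ∘ suc)

  count-singleton : ∀ {n} (a : Fin n) (dQ : Decidable (a ≡_)) → count (a ≡_) dQ ≡ 1
  count-singleton {suc n} zero dQ with dQ zero
  ... | no ¬q = ⊥-elim (¬q refl)
  ... | yes _ = cong suc (count-empty (dQ ∘ suc) (λ y → Finₚ.0≢1+n))
  count-singleton {suc n} (suc a) dQ with dQ zero
  ... | yes ()
  ... | no _ = trans (count-ext (dQ ∘ suc) (a Finₚ.≟_) (λ _ → Finₚ.suc-injective) (λ _ → cong suc))
                     (count-singleton a (a Finₚ.≟_))

  Img : ∀ {n m} (S : Fin n → Set) (h : Fin n → Fin m) → Fin m → Set
  Img S h y = ∃ λ x → S x × h x ≡ y

  img? : ∀ {n m} {S : Fin n → Set} (dS : Decidable S) (h : Fin n → Fin m) → Decidable (Img S h)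
  img? dS h y = any? (λ x → dS x ×-dec (h x Finₚ.≟ y))

  InjectiveOn : ∀ {n m} (S : Fin n → Set) (h : Fin n → Fin m) → Set
  InjectiveOn S h = ∀ x x' → S x → S x' → h x ≡ h x' → x ≡ x'

  injectiveOn-tail : ∀ {n m} {S : Fin (suc n) → Set} {h : Fin (suc n) → Fin m} →
    InjectiveOn S h → InjectiveOn (S ∘ suc) (h ∘ suc)
  injectiveOn-tail inj x x' sx sx' e = Finₚ.suc-injective (inj (suc x) (suc x') sx sx' e)

  count-img : ∀ {n m} {S : Fin n → Set} (dS : Decidable S) (h : Fin n → Fin m) →
    InjectiveOn S h → (dI : Decidable (Img S h)) → count (Img S h) dI ≡ count S dS
  count-img {zero} dS h inj dI = count-empty dI (λ { y (() , _) })
  count-img {suc n} dS h inj dI with dS zero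
  ... | yes s₀ = trans
          (count-union (h zero Finₚ.≟_) (img? (dS ∘ suc) (h ∘ suc)) dI
            (λ { y e (x , sx , e') → Finₚ.0≢1+n (inj zero (suc x) s₀ sx (trans e (sym e'))) })
            (λ { y (zero , _ , e) → inj₁ e ; y (suc x , sx , e) → inj₂ (x , sx , e) })
            (λ { y (inj₁ e) → zero , s₀ , e ; y (inj₂ (x , sx , e)) → suc x , sx , e }))
          (cong₂ _+_ (count-singleton (h zero) (h zero Finₚ.≟_))
                     (count-img (dS ∘ suc) (h ∘ suc) (injectiveOn-tail inj) _))
  ... | no ¬s₀ = trans
          (count-ext dI (img? (dS ∘ suc) (h ∘ suc))
            (λ { y (zero , s₀ , _) → ⊥-elim (¬s₀ s₀) ; y (suc x , sx , e) → x , sx , e })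
            (λ { y (x , sx , e) → suc x , sx , e }))
          (count-img (dS ∘ suc) (h ∘ suc) (injectiveOn-tail inj) _)

  count-bij : ∀ {n} {P Q : Fin n → Set} (dQ : Decidable Q) (dP : Decidable P)
    (f g : Fin n → Fin n) → (∀ x → g (f x) ≡ x) → (∀ y → f (g y) ≡ y) →
    (∀ x → Q x → P (f x)) → (∀ x → P (f x) → Q x) → count Q dQ ≡ count P dP
  count-bij {P = P} dQ dP f g gf fg QP PQ = trans
    (sym (count-img dQ f (λ x x' _ _ e → trans (sym (gf x)) (trans (cong g e) (gf x'))) (img? dQ f)))
    (count-ext (img? dQ f) dP (λ { y (x , qx , refl) → QP x qx })
      (λ y py → g y , PQ (g y) (subst P (sym (fg y)) py) , fg y))

  count-onto : ∀ {n} {S T : Fin n → Set} (dS : Decidable S) (dT : Decidable T) (h : Fin n → Fin n) →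
    InjectiveOn S h → (∀ x → S x → T (h x)) → count S dS ≡ count T dT → ∀ y → T y → Img S h y
  count-onto dS dT h inj ST |S|≡|T| y ty with img? dS h y
  ... | yes im = im
  ... | no ¬im = ⊥-elim (ℕₚ.<-irrefl (trans (count-img dS h inj (img? dS h)) |S|≡|T|)
          (count-strict (img? dS h) dT (λ { _ (x , sx , refl) → ST x sx }) y ty ¬im))

  select-rank : ∀ {n} {P : Fin n → Set} (dP : Decidable P) (r : ℕ) → r ℕ.< count P dP →
    Σ (Fin n) λ x → P x × (∀ (dA : Decidable (λ y → P y × x < y)) → count (λ y → P y × x < y) dA ≡ r)
  select-rank {suc n} {P} dP r r<|P| with r ℕ.<? count (P ∘ suc) (dP ∘ suc)
  ... | yes r<|P∘suc| with select-rank (dP ∘ suc) r r<|P∘suc|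
  ...   | x , px , rank = suc x , px , above
    where
    above : ∀ dA → count (λ y → P y × suc x < y) dA ≡ r
    above dA with dA zero
    ... | yes (_ , ())
    ... | no _ = trans (count-ext (dA ∘ suc) (λ y → dP (suc y) ×-dec (x <? y))
      (λ { y (py , s≤s x<y) → py , x<y }) (λ { y (py , x<y) → py , s≤s x<y })) (rank _)
  select-rank {suc n} {P} dP r r<|P| | no r≮|P∘suc| with dP zero
  ... | no _   = ⊥-elim (r≮|P∘suc| r<|P|)
  ... | yes p₀ = zero , p₀ , above
    where
    above : ∀ dA → count (λ y → P y × zero {n} < y) dA ≡ r
    above dA with dA zero
    ... | yes (_ , ())
    ... | no _ = trans (count-ext (dA ∘ suc) (dP ∘ suc) (λ _ → proj₁) (λ _ py → py , s≤s z≤n))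
      (ℕₚ.≤-antisym (ℕₚ.≮⇒≥ r≮|P∘suc|) (ℕ.s≤s⁻¹ r<|P|))

  zeros+ones : ∀ {n} (f : Fin n → Bool) → zeros f + count (λ i → f i ≡ true) (λ i → f i Bool.≟ true) ≡ n
  zeros+ones {zero} f = refl
  zeros+ones {suc n} f with f zero
  ... | false = cong suc (zeros+ones (f ∘ suc))
  ... | true  = trans (ℕₚ.+-suc _ _) (cong suc (zeros+ones (f ∘ suc)))

  ⌊⌋≡true⇒ : ∀ {P : Set} (d : Dec P) → ⌊ d ⌋ ≡ true → P
  ⌊⌋≡true⇒ (yes p) _ = p

  ⌊⌋≡false⇒ : ∀ {P : Set} (d : Dec P) → ⌊ d ⌋ ≡ false → ¬ P
  ⌊⌋≡false⇒ (no ¬p) _ = ¬p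

  ⇒⌊⌋≡true : ∀ {P : Set} (d : Dec P) → P → ⌊ d ⌋ ≡ true
  ⇒⌊⌋≡true (yes _) _ = refl
  ⇒⌊⌋≡true (no ¬p) p = ⊥-elim (¬p p)

  ⇒⌊⌋≡false : ∀ {P : Set} (d : Dec P) → ¬ P → ⌊ d ⌋ ≡ false
  ⇒⌊⌋≡false (yes p) ¬p = ⊥-elim (¬p p)
  ⇒⌊⌋≡false (no _) _ = refl

  module PermutationFacts {n : ℕ} (σ : Permutation′ n) where

    σʳ σˡ : Fin n → Fin n
    σʳ = σ ⟨$⟩ʳ_
    σˡ = σ ⟨$⟩ˡ_

    σˡ∘σʳ : ∀ i → σˡ (σʳ i) ≡ i
    σˡ∘σʳ i = inverseˡ σ

    σʳ∘σˡ : ∀ i → σʳ (σˡ i) ≡ i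
    σʳ∘σˡ i = inverseʳ σ

    pos-true⇒ : ∀ i → pos σ i ≡ true → i < σʳ i
    pos-true⇒ i = ⌊⌋≡true⇒ (i <? σʳ i)

    pos-false⇒ : ∀ i → pos σ i ≡ false → σʳ i ≤ i
    pos-false⇒ i e = ℕₚ.≮⇒≥ (⌊⌋≡false⇒ (i <? σʳ i) e)

    ⇒pos-true : ∀ i → i < σʳ i → pos σ i ≡ true
    ⇒pos-true i = ⇒⌊⌋≡true (i <? σʳ i)

    ⇒pos-false : ∀ i → σʳ i ≤ i → pos σ i ≡ false
    ⇒pos-false i le = ⇒⌊⌋≡false (i <? σʳ i) (ℕₚ.≤⇒≯ le)

    val-false⇒ : ∀ ℓ → val σ ℓ ≡ false → ℓ ≤ σˡ ℓ
    val-false⇒ ℓ e = ℕₚ.≮⇒≥ (⌊⌋≡false⇒ (σˡ ℓ <? ℓ) e)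

    ⇒val-true : ∀ ℓ → σˡ ℓ < ℓ → val σ ℓ ≡ true
    ⇒val-true ℓ = ⇒⌊⌋≡true (σˡ ℓ <? ℓ)

    ⇒val-false : ∀ ℓ → ℓ ≤ σˡ ℓ → val σ ℓ ≡ false
    ⇒val-false ℓ le = ⇒⌊⌋≡false (σˡ ℓ <? ℓ) (ℕₚ.≤⇒≯ le)

    nest-low-values : ∀ k → σʳ k ≤ k → (d : Decidable (λ ℓ → ℓ < σʳ k × k < σˡ ℓ)) →
      nest σ k ≡ count (λ ℓ → ℓ < σʳ k × k < σˡ ℓ) d
    nest-low-values k σk≤k d = count-ext (nestCond? σ k) d
      (λ { ℓ (inj₁ (ℓ<σk , _ , k<σ⁻ℓ)) → ℓ<σk , k<σ⁻ℓ
         ; ℓ (inj₂ (_ , k<σk , _)) → ⊥-elim (ℕₚ.<⇒≱ k<σk σk≤k) })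
      (λ { ℓ (ℓ<σk , k<σ⁻ℓ) → inj₁ (ℓ<σk , σk≤k , k<σ⁻ℓ) })

    nest-low-positions : ∀ k → σʳ k ≤ k → (d : Decidable (λ m → k < m × σʳ m < σʳ k)) →
      nest σ k ≡ count (λ m → k < m × σʳ m < σʳ k) d
    nest-low-positions k σk≤k d = trans (nest-low-values k σk≤k (λ ℓ → (ℓ <? σʳ k) ×-dec (k <? σˡ ℓ)))
      (count-bij _ d σˡ σʳ σʳ∘σˡ σˡ∘σʳ
        (λ ℓ (ℓ<σk , k<σ⁻ℓ) → k<σ⁻ℓ , subst (_< σʳ k) (sym (σʳ∘σˡ ℓ)) ℓ<σk)
        (λ ℓ (k<σ⁻ℓ , σσ⁻ℓ<σk) → subst (_< σʳ k) (σʳ∘σˡ ℓ) σσ⁻ℓ<σk , k<σ⁻ℓ))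

    nest-up-positions : ∀ k → k < σʳ k → (d : Decidable (λ m → m < k × σʳ k < σʳ m)) →
      nest σ k ≡ count (λ m → m < k × σʳ k < σʳ m) d
    nest-up-positions k k<σk d = count-ext (nestCond? σ k) d
      (λ { m (inj₁ (_ , σk≤k , _)) → ⊥-elim (ℕₚ.<⇒≱ k<σk σk≤k)
         ; m (inj₂ (m<k , _ , σk<σm)) → m<k , σk<σm })
      (λ { m (m<k , σk<σm) → inj₂ (m<k , k<σk , σk<σm) })

    nest-up-values : ∀ k → k < σʳ k → (d : Decidable (λ x → σʳ k < x × σˡ x < k)) →
      nest σ k ≡ count (λ x → σʳ k < x × σˡ x < k) d
    nest-up-values k k<σk d = trans (nest-up-positions k k<σk (λ m → (m <? k) ×-dec (σʳ k <? σʳ m)))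
      (count-bij _ d σʳ σˡ σˡ∘σʳ σʳ∘σˡ
        (λ m (m<k , σk<σm) → σk<σm , subst (_< k) (sym (σˡ∘σʳ m)) m<k)
        (λ m (σk<σm , σ⁻σm<k) → subst (_< k) (σˡ∘σʳ m) σ⁻σm<k , σk<σm))

    Before : Fin n → Fin n → Set
    Before k j = σʳ j ≤ j × j < k

    before? : ∀ k → Decidable (Before k)
    before? k j = (σʳ j ≤? j) ×-dec (j <? k)

    Reaching : Fin n → Fin n → Set
    Reaching k j = σʳ j ≤ j × σʳ j ≤ k

    reaching? : ∀ k → Decidable (Reaching k)
    reaching? k j = (σʳ j ≤? j) ×-dec (σʳ j ≤? k)

    zerosBefore-pos : ∀ k → zerosBefore (pos σ) k ≡ count (Before k) (before? k)
    zerosBefore-pos k = count-ext _ (before? k)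
      (λ j (e , j<k) → pos-false⇒ j e , j<k) (λ j (σj≤j , j<k) → ⇒pos-false j σj≤j , j<k)

    zerosUpTo-val : ∀ k → zerosUpTo (val σ) k ≡ count (Reaching k) (reaching? k)
    zerosUpTo-val k = count-bij _ (reaching? k) σˡ σʳ σʳ∘σˡ σˡ∘σʳ
      (λ ℓ (e , ℓ≤k) → subst (_≤ σˡ ℓ) (sym (σʳ∘σˡ ℓ)) (val-false⇒ ℓ e) ,
                        subst (_≤ k) (sym (σʳ∘σˡ ℓ)) ℓ≤k)
      (λ ℓ (σσ⁻ℓ≤σ⁻ℓ , σσ⁻ℓ≤k) → ⇒val-false ℓ (subst (_≤ σˡ ℓ) (σʳ∘σˡ ℓ) σσ⁻ℓ≤σ⁻ℓ) ,
                                  subst (_≤ k) (σʳ∘σˡ ℓ) σσ⁻ℓ≤k)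

    crossing-balance : (k : Fin n) →
      count (λ j → k < j × σʳ j ≤ k) (λ j → (k <? j) ×-dec (σʳ j ≤? k)) ≡
      count (λ j → j ≤ k × k < σʳ j) (λ j → (j ≤? k) ×-dec (k <? σʳ j))
    crossing-balance k = ℕₚ.+-cancelˡ-≡ (count Stay stay?) _ _ (begin
        count Stay stay? + count Down _
          ≡⟨ by-image ⟨
        count (λ j → σʳ j ≤ k) (λ j → σʳ j ≤? k)
          ≡⟨ count-bij _ _ σʳ σˡ σˡ∘σʳ σʳ∘σˡ (λ _ e → e) (λ _ e → e) ⟩
        count (λ (j : Fin n) → j ≤ k) (λ j → j ≤? k)
          ≡⟨ by-position ⟩
        count Stay stay? + count Up _ ∎)
      where
      open ≡-Reasoning
      Stay Down Up : Fin n → Set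
      Stay j = j ≤ k × σʳ j ≤ k
      Down j = k < j × σʳ j ≤ k
      Up j = j ≤ k × k < σʳ j
      stay? : Decidable Stay
      stay? j = (j ≤? k) ×-dec (σʳ j ≤? k)

      split-down : ∀ j → σʳ j ≤ k → Dec (j ≤ k) → Stay j ⊎ Down j
      split-down j σj≤k (yes j≤k) = inj₁ (j≤k , σj≤k)
      split-down j σj≤k (no j≰k) = inj₂ (ℕₚ.≰⇒> j≰k , σj≤k)
      by-image : count (λ j → σʳ j ≤ k) (λ j → σʳ j ≤? k) ≡ count Stay stay? + count Down _
      by-image = count-union stay? _ _ (λ { j (j≤k , _) (k<j , _) → ℕₚ.<⇒≱ k<j j≤k })
        (λ j σj≤k → split-down j σj≤k (j ≤? k))
        (λ { j (inj₁ (_ , σj≤k)) → σj≤k ; j (inj₂ (_ , σj≤k)) → σj≤k })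

      split-up : ∀ j → j ≤ k → Dec (σʳ j ≤ k) → Stay j ⊎ Up j
      split-up j j≤k (yes σj≤k) = inj₁ (j≤k , σj≤k)
      split-up j j≤k (no σj≰k) = inj₂ (j≤k , ℕₚ.≰⇒> σj≰k)
      by-position : count (λ (j : Fin n) → j ≤ k) (λ j → j ≤? k) ≡ count Stay stay? + count Up _
      by-position = count-union stay? _ _ (λ { j (_ , σj≤k) (_ , k<σj) → ℕₚ.<⇒≱ k<σj σj≤k })
        (λ j j≤k → split-up j j≤k (σʳ j ≤? k))
        (λ { j (inj₁ (j≤k , _)) → j≤k ; j (inj₂ (j≤k , _)) → j≤k })

    -- For a non-excedance k, the positions before k counted by pos σ and the positions
    -- counted by nest σ k all reach at most σ k ≤ k, and so does k itself.
    nest-bound-low : ∀ k → σʳ k ≤ k → suc (nest σ k + zerosBefore (pos σ) k) ℕ.≤ zerosUpTo (val σ) k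
    nest-bound-low k σk≤k = begin
      suc (nest σ k + zerosBefore (pos σ) k)
        ≡⟨ cong suc (cong₂ _+_ (nest-low-positions k σk≤k nested?) (zerosBefore-pos k)) ⟩
      suc (count Nested nested? + count (Before k) (before? k))
        ≡⟨ cong suc (count-⊎ nested? (before? k) (λ { j (k<j , _) (_ , j<k) → Finₚ.<-asym k<j j<k })) ⟨
      suc (count (λ j → Nested j ⊎ Before k j) _)
        ≤⟨ count-strict _ (reaching? k) reaches k (σk≤k , σk≤k)
             (λ { (inj₁ (k<k , _)) → Finₚ.<-irrefl refl k<k ; (inj₂ (_ , k<k)) → Finₚ.<-irrefl refl k<k }) ⟩
      count (Reaching k) (reaching? k)
        ≡⟨ zerosUpTo-val k ⟨
      zerosUpTo (val σ) k ∎
      where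
      open ℕₚ.≤-Reasoning
      Nested : Fin n → Set
      Nested m = k < m × σʳ m < σʳ k
      nested? : Decidable Nested
      nested? m = (k <? m) ×-dec (σʳ m <? σʳ k)
      reaches : ∀ j → Nested j ⊎ Before k j → Reaching k j
      reaches j (inj₁ (k<j , σj<σk)) = ℕₚ.≤-trans σj≤k (ℕₚ.<⇒≤ k<j) , σj≤k
        where
        σj≤k : σʳ j ≤ k
        σj≤k = ℕₚ.<⇒≤ (ℕₚ.<-≤-trans σj<σk σk≤k)
      reaches j (inj₂ (σj≤j , j<k)) = σj≤j , ℕₚ.≤-trans σj≤j (ℕₚ.<⇒≤ j<k)

    -- For an excedance k, the positions counted by nest σ k, together with k, cross
    -- the cut after k upwards; by balance as many cross it downwards, and those,
    -- with the non-excedances before k, are exactly the positions reaching ≤ k.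
    nest-bound-up : ∀ k → k < σʳ k → suc (nest σ k + zerosBefore (pos σ) k) ℕ.≤ zerosUpTo (val σ) k
    nest-bound-up k k<σk = begin
      suc (nest σ k + zerosBefore (pos σ) k)
        ≡⟨ cong suc (cong₂ _+_ (nest-up-positions k k<σk nested?) (zerosBefore-pos k)) ⟩
      suc (count Nested nested?) + count (Before k) (before? k)
        ≤⟨ ℕₚ.+-monoˡ-≤ _ (count-strict nested? up? nested⇒up k (ℕₚ.≤-refl , k<σk)
                             (λ (k<k , _) → Finₚ.<-irrefl refl k<k)) ⟩
      count Up up? + count (Before k) (before? k)
        ≡⟨ cong (_+ count (Before k) (before? k)) (crossing-balance k) ⟨
      count Down down? + count (Before k) (before? k)
        ≡⟨ ℕₚ.+-comm (count Down down?) _ ⟩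
      count (Before k) (before? k) + count Down down?
        ≡⟨ count-union (before? k) down? (reaching? k) (λ { j (_ , j<k) (k<j , _) → Finₚ.<-asym j<k k<j })
             (λ j (σj≤j , σj≤k) → split j σj≤j σj≤k (Finₚ.<-cmp j k)) join ⟨
      count (Reaching k) (reaching? k)
        ≡⟨ zerosUpTo-val k ⟨
      zerosUpTo (val σ) k ∎
      where
      open ℕₚ.≤-Reasoning
      Nested Up Down : Fin n → Set
      Nested m = m < k × σʳ k < σʳ m
      Up j = j ≤ k × k < σʳ j
      Down j = k < j × σʳ j ≤ k
      nested? : Decidable Nested
      nested? m = (m <? k) ×-dec (σʳ k <? σʳ m)
      up? : Decidable Up
      up? j = (j ≤? k) ×-dec (k <? σʳ j)
      down? : Decidable Down
      down? j = (k <? j) ×-dec (σʳ j ≤? k)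
      nested⇒up : ∀ m → Nested m → Up m
      nested⇒up m (m<k , σk<σm) = ℕₚ.<⇒≤ m<k , Finₚ.<-trans k<σk σk<σm
      split : ∀ j → σʳ j ≤ j → σʳ j ≤ k → Tri (j < k) (j ≡ k) (k < j) → Before k j ⊎ Down j
      split j σj≤j σj≤k (tri< j<k _ _) = inj₁ (σj≤j , j<k)
      split j σj≤j σj≤k (tri≈ _ refl _) = ⊥-elim (ℕₚ.<⇒≱ k<σk σj≤j)
      split j σj≤j σj≤k (tri> _ _ k<j) = inj₂ (k<j , σj≤k)
      join : ∀ j → Before k j ⊎ Down j → Reaching k j
      join j (inj₁ (σj≤j , j<k)) = σj≤j , ℕₚ.≤-trans σj≤j (ℕₚ.<⇒≤ j<k)
      join j (inj₂ (k<j , σj≤k)) = ℕₚ.≤-trans σj≤k (ℕₚ.<⇒≤ k<j) , σj≤k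

    nest-bound : ∀ k → suc (nest σ k + zerosBefore (pos σ) k) ℕ.≤ zerosUpTo (val σ) k
    nest-bound k = by-cases (k <? σʳ k)
      where
      by-cases : Dec (k < σʳ k) → suc (nest σ k + zerosBefore (pos σ) k) ℕ.≤ zerosUpTo (val σ) k
      by-cases (yes k<σk) = nest-bound-up k k<σk
      by-cases (no k≮σk) = nest-bound-low k (ℕₚ.≮⇒≥ k≮σk)

  -- Two permutations σ, τ with the same val and pos, at a position k with σ k < τ k:
  -- if they agree on the side of k that matters, their nesting indices at k differ.
  module Comparison {n : ℕ} (σ τ : Permutation′ n)
    (same-val : ∀ i → val σ i ≡ val τ i) (same-pos : ∀ i → pos σ i ≡ pos τ i) where

    open PermutationFacts σ using (σʳ; σˡ; σʳ∘σˡ; σˡ∘σʳ)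
    open PermutationFacts τ using () renaming (σʳ to τʳ; σˡ to τˡ; σʳ∘σˡ to τʳ∘τˡ; σˡ∘σʳ to τˡ∘τʳ)
    module S = PermutationFacts σ
    module T = PermutationFacts τ

    -- At a non-excedance k, agreement on the earlier non-excedances forces nest σ k < nest τ k:
    -- nest ρ k counts the values ℓ < ρ k with ρ⁻¹ ℓ > k, and this set grows from σ to τ.
    module _ (k : Fin n) (agree : ∀ j → j < k → pos σ j ≡ false → σʳ j ≡ τʳ j)
             (σk≤k : σʳ k ≤ k) (σk<τk : σʳ k < τʳ k) where

      LeftOf : Permutation′ n → Fin n → Set
      LeftOf ρ ℓ = ℓ < ρ ⟨$⟩ʳ k × k < ρ ⟨$⟩ˡ ℓ

      leftOf? : ∀ ρ → Decidable (LeftOf ρ)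
      leftOf? ρ ℓ = (ℓ <? ρ ⟨$⟩ʳ k) ×-dec (k <? ρ ⟨$⟩ˡ ℓ)

      τk≤k : τʳ k ≤ k
      τk≤k = T.pos-false⇒ k (trans (sym (same-pos k)) (S.⇒pos-false k σk≤k))

      -- A value ℓ ≠ τ k whose σ-preimage lies weakly beyond both ℓ and k has its τ-preimage beyond k:
      -- a τ-preimage j < k would be a non-excedance of τ, hence of σ, where σ and τ agree.
      beyond-k : ∀ ℓ → ℓ ≤ σˡ ℓ → k ≤ σˡ ℓ → ℓ ≢ τʳ k → k < τˡ ℓ
      beyond-k ℓ ℓ≤σ⁻ℓ k≤σ⁻ℓ ℓ≢τk with Finₚ.<-cmp (τˡ ℓ) k
      ... | tri> _ _ k<τ⁻ℓ = k<τ⁻ℓ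
      ... | tri≈ _ τ⁻ℓ≡k _ = ⊥-elim (ℓ≢τk (trans (sym (τʳ∘τˡ ℓ)) (cong τʳ τ⁻ℓ≡k)))
      ... | tri< τ⁻ℓ<k _ _ = ⊥-elim (ℕₚ.<⇒≱ (subst (_< k) (sym σ⁻ℓ≡τ⁻ℓ) τ⁻ℓ<k) k≤σ⁻ℓ)
        where
        ℓ≤τ⁻ℓ : ℓ ≤ τˡ ℓ
        ℓ≤τ⁻ℓ = T.val-false⇒ ℓ (trans (sym (same-val ℓ)) (S.⇒val-false ℓ ℓ≤σ⁻ℓ))
        low-in-σ : pos σ (τˡ ℓ) ≡ false
        low-in-σ = trans (same-pos _) (T.⇒pos-false _ (subst (_≤ τˡ ℓ) (sym (τʳ∘τˡ ℓ)) ℓ≤τ⁻ℓ))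
        σ⁻ℓ≡τ⁻ℓ : σˡ ℓ ≡ τˡ ℓ
        σ⁻ℓ≡τ⁻ℓ = trans (cong σˡ (sym (trans (agree _ τ⁻ℓ<k low-in-σ) (τʳ∘τˡ ℓ)))) (σˡ∘σʳ _)

      nest-grows : nest σ k ℕ.< nest τ k
      nest-grows = subst₂ ℕ._<_
        (sym (S.nest-low-values k σk≤k (leftOf? σ))) (sym (T.nest-low-values k τk≤k (leftOf? τ)))
        (count-strict (leftOf? σ) (leftOf? τ) grows (σʳ k) new (λ (σk<σk , _) → Finₚ.<-irrefl refl σk<σk))
        where
        grows : ∀ ℓ → LeftOf σ ℓ → LeftOf τ ℓ
        grows ℓ (ℓ<σk , k<σ⁻ℓ) = Finₚ.<-trans ℓ<σk σk<τk ,
          beyond-k ℓ (ℕₚ.<⇒≤ (ℕₚ.<-≤-trans ℓ<σk (ℕₚ.≤-trans σk≤k (ℕₚ.<⇒≤ k<σ⁻ℓ)))) (ℕₚ.<⇒≤ k<σ⁻ℓ)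
            (λ { refl → Finₚ.<-asym ℓ<σk σk<τk })
        new : LeftOf τ (σʳ k)
        new = σk<τk , beyond-k (σʳ k) (subst (σʳ k ≤_) (sym (σˡ∘σʳ k)) σk≤k)
                        (Finₚ.≤-reflexive (sym (σˡ∘σʳ k))) (λ σk≡τk → Finₚ.<-irrefl σk≡τk σk<τk)

    -- At an excedance k, agreement on all later positions forces nest τ k < nest σ k:
    -- nest ρ k counts the values x > ρ k with ρ⁻¹ x < k, and this set shrinks from σ to τ.
    module _ (k : Fin n) (agree : ∀ m → k < m → σʳ m ≡ τʳ m)
             (k<σk : k < σʳ k) (σk<τk : σʳ k < τʳ k) where

      RightOf : Permutation′ n → Fin n → Set
      RightOf ρ x = ρ ⟨$⟩ʳ k < x × ρ ⟨$⟩ˡ x < k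

      rightOf? : ∀ ρ → Decidable (RightOf ρ)
      rightOf? ρ x = (ρ ⟨$⟩ʳ k <? x) ×-dec (ρ ⟨$⟩ˡ x <? k)

      k<τk : k < τʳ k
      k<τk = T.pos-true⇒ k (trans (sym (same-pos k)) (S.⇒pos-true k k<σk))

      -- A value x ≠ σ k with τ-preimage at most k has σ-preimage before k,
      -- since after k the two permutations agree.
      before-k : ∀ x → x ≢ σʳ k → τˡ x ≤ k → σˡ x < k
      before-k x x≢σk τ⁻x≤k with Finₚ.<-cmp (σˡ x) k
      ... | tri< σ⁻x<k _ _ = σ⁻x<k
      ... | tri≈ _ σ⁻x≡k _ = ⊥-elim (x≢σk (trans (sym (σʳ∘σˡ x)) (cong σʳ σ⁻x≡k)))
      ... | tri> _ _ k<σ⁻x = ⊥-elim (ℕₚ.<⇒≱ (subst (k <_) σ⁻x≡τ⁻x k<σ⁻x) τ⁻x≤k)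
        where
        σ⁻x≡τ⁻x : σˡ x ≡ τˡ x
        σ⁻x≡τ⁻x = trans (sym (τˡ∘τʳ _)) (cong τˡ (trans (sym (agree _ k<σ⁻x)) (σʳ∘σˡ x)))

      nest-shrinks : nest τ k ℕ.< nest σ k
      nest-shrinks = subst₂ ℕ._<_
        (sym (T.nest-up-values k k<τk (rightOf? τ))) (sym (S.nest-up-values k k<σk (rightOf? σ)))
        (count-strict (rightOf? τ) (rightOf? σ) shrinks (τʳ k) new (λ (τk<τk , _) → Finₚ.<-irrefl refl τk<τk))
        where
        shrinks : ∀ x → RightOf τ x → RightOf σ x
        shrinks x (τk<x , τ⁻x<k) = Finₚ.<-trans σk<τk τk<x ,
          before-k x (λ { refl → Finₚ.<-asym σk<τk τk<x }) (ℕₚ.<⇒≤ τ⁻x<k)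
        new : RightOf σ (τʳ k)
        new = σk<τk , before-k (τʳ k) (λ τk≡σk → Finₚ.<-irrefl (sym τk≡σk) σk<τk)
                        (Finₚ.≤-reflexive (τˡ∘τʳ k))

  -- They agree at
  -- the non-excedances by induction from left to right, and then everywhere by
  -- induction from right to left; at a first disagreement σ k < τ k (or the
  -- symmetric one) the comparison lemmas make the nesting indices differ.
  realisation-unique : ∀ {n} (σ τ : Permutation′ n) →
    (∀ i → val σ i ≡ val τ i) → (∀ i → pos σ i ≡ pos τ i) → (∀ i → nest σ i ≡ nest τ i) →
    ∀ i → σ ⟨$⟩ʳ i ≡ τ ⟨$⟩ʳ i
  realisation-unique {n} σ τ same-val same-pos same-nest = All.wfRec >-wellFounded _ _ agree-from-right
    where
    open PermutationFacts σ using (σʳ)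
    open PermutationFacts τ using () renaming (σʳ to τʳ)
    module S = PermutationFacts σ
    module T = PermutationFacts τ
    module στ = Comparison σ τ same-val same-pos
    module τσ = Comparison τ σ (λ i → sym (same-val i)) (λ i → sym (same-pos i))

    agree-low : ∀ k → pos σ k ≡ false → σʳ k ≡ τʳ k
    agree-low = All.wfRec <-wellFounded _ _ step
      where
      step : ∀ k → (∀ {j} → j < k → pos σ j ≡ false → σʳ j ≡ τʳ j) → pos σ k ≡ false → σʳ k ≡ τʳ k
      step k agree low with Finₚ.<-cmp (σʳ k) (τʳ k)
      ... | tri≈ _ σk≡τk _ = σk≡τk
      ... | tri< σk<τk _ _ = ⊥-elim (ℕₚ.<-irrefl (same-nest k)
              (στ.nest-grows k (λ j j<k → agree j<k) (S.pos-false⇒ k low) σk<τk))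
      ... | tri> _ _ τk<σk = ⊥-elim (ℕₚ.<-irrefl (sym (same-nest k))
              (τσ.nest-grows k (λ j j<k lowτ → sym (agree j<k (trans (same-pos j) lowτ)))
                 (T.pos-false⇒ k (trans (sym (same-pos k)) low)) τk<σk))

    agree-from-right : ∀ k → (∀ {m} → k < m → σʳ m ≡ τʳ m) → σʳ k ≡ τʳ k
    agree-from-right k agree = by-pos (pos σ k) refl
      where
      by-pos : ∀ b → pos σ k ≡ b → σʳ k ≡ τʳ k
      by-pos false low = agree-low k low
      by-pos true up with Finₚ.<-cmp (σʳ k) (τʳ k)
      ... | tri≈ _ σk≡τk _ = σk≡τk
      ... | tri< σk<τk _ _ = ⊥-elim (ℕₚ.<-irrefl (sym (same-nest k))
              (στ.nest-shrinks k (λ m k<m → agree k<m) (S.pos-true⇒ k up) σk<τk))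
      ... | tri> _ _ τk<σk = ⊥-elim (ℕₚ.<-irrefl (same-nest k)
              (τσ.nest-shrinks k (λ m k<m → sym (agree k<m))
                 (T.pos-true⇒ k (trans (sym (same-pos k)) up)) τk<σk))

  -- Sources S are matched injectively to
  -- targets T (with |S| = |T|) so that each source k gets an admissible target
  -- (admissibility being upward closed) and exactly c k of the sources m < k get
  -- a larger target than k. The sources are processed from right to left: k takes
  -- the admissible target, not yet used by the sources after it, that has exactly
  -- c k such free targets above it. This is possible as long as c k is smaller
  -- than the number of admissible targets minus the number of sources after k.
  module GreedyMatching {n : ℕ}
    (S T : Fin n → Set) (S? : Decidable S) (T? : Decidable T)
    (Adm : Fin n → Fin n → Set) (adm? : ∀ x k → Dec (Adm x k))
    (adm-up : ∀ {x y k} → Adm x k → x < y → Adm y k)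
    (c : Fin n → ℕ)
    (|S|≡|T| : count S S? ≡ count T T?)
    (room : ∀ k → S k → suc (c k + count (λ m → S m × k < m) (λ m → S? m ×-dec (k <? m)))
                          ℕ.≤ count (λ x → T x × Adm x k) (λ x → T? x ×-dec adm? x k)) where

    UsedFrom : Fin n → (Fin n → Fin n) → Fin n → Set
    UsedFrom m h = Img (λ m' → S m' × m ≤ m') h

    usedFrom? : ∀ m h → Decidable (UsedFrom m h)
    usedFrom? m h = img? (λ m' → S? m' ×-dec (m ≤? m')) h

    Free : Fin n → (Fin n → Fin n) → Fin n → Set
    Free m h y = T y × h m < y × ¬ UsedFrom m h y

    free? : ∀ m h → Decidable (Free m h)
    free? m h y = T? y ×-dec ((h m <? y) ×-dec ¬? (usedFrom? m h y))

    -- The state after the sources at positions ≥ j have been matched.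
    record Invariant (j : ℕ) (h : Fin n → Fin n) : Set where
      field
        admissible : ∀ m → S m → j ℕ.≤ toℕ m → T (h m) × Adm (h m) m
        injective  : ∀ m m' → S m → S m' → j ℕ.≤ toℕ m → j ℕ.≤ toℕ m' → h m ≡ h m' → m ≡ m'
        rank       : ∀ m → S m → j ℕ.≤ toℕ m → c m ≡ count (Free m h) (free? m h)

    initial : Invariant n (λ i → i)
    initial = record
      { admissible = λ m _ n≤m → ⊥-elim (ℕₚ.<⇒≱ (Finₚ.toℕ<n m) n≤m)
      ; injective = λ m _ _ _ n≤m _ _ → ⊥-elim (ℕₚ.<⇒≱ (Finₚ.toℕ<n m) n≤m)
      ; rank = λ m _ n≤m → ⊥-elim (ℕₚ.<⇒≱ (Finₚ.toℕ<n m) n≤m) }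

    after : ∀ {k m : Fin n} → toℕ k ℕ.≤ toℕ m → m ≢ k → k < m
    after k≤m m≢k = ℕₚ.≤∧≢⇒< k≤m (λ k≡m → m≢k (Finₚ.toℕ-injective (sym k≡m)))

    skip : ∀ k h → ¬ S k → Invariant (suc (toℕ k)) h → Invariant (toℕ k) h
    skip k h ¬sk inv = record
      { admissible = λ m sm k≤m → admissible m sm (later sm k≤m)
      ; injective = λ m m' sm sm' k≤m k≤m' → injective m m' sm sm' (later sm k≤m) (later sm' k≤m')
      ; rank = λ m sm k≤m → rank m sm (later sm k≤m) }
      where
      open Invariant inv
      later : ∀ {m} → S m → toℕ k ℕ.≤ toℕ m → k < m
      later sm k≤m = after k≤m (λ { refl → ¬sk sm })

    module Assign (k : Fin n) (h : Fin n → Fin n) (inv : Invariant (suc (toℕ k)) h) (sk : S k) where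
      open Invariant inv

      Used : Fin n → Set
      Used = Img (λ m → S m × k < m) h

      used? : Decidable Used
      used? = img? (λ m → S? m ×-dec (k <? m)) h

      Available : Fin n → Set
      Available x = T x × Adm x k × ¬ Used x

      available? : Decidable Available
      available? x = T? x ×-dec (adm? x k ×-dec ¬? (used? x))

      #later : ℕ
      #later = count (λ m → S m × k < m) (λ m → S? m ×-dec (k <? m))

      #used : count Used used? ≡ #later
      #used = count-img _ h (λ m m' (sm , k<m) (sm' , k<m') → injective m m' sm sm' k<m k<m') used?

      -- Admissible targets are available or used, and at most #later are used.
      enough : c k ℕ.< count Available available?
      enough = ℕₚ.+-cancelʳ-≤ #later (suc (c k)) _ (begin
        suc (c k) + #later
          ≤⟨ room k sk ⟩
        count (λ x → T x × Adm x k) (λ x → T? x ×-dec adm? x k)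
          ≤⟨ count-mono _ _ available-or-used ⟩
        count (λ x → Available x ⊎ Used x) _
          ≡⟨ count-⊎ available? used? (λ x (_ , _ , unused) → unused) ⟩
        count Available available? + count Used used?
          ≡⟨ cong (count Available available? +_) #used ⟩
        count Available available? + #later ∎)
        where
        open ℕₚ.≤-Reasoning
        available-or-used : ∀ x → T x × Adm x k → Available x ⊎ Used x
        available-or-used x (tx , adm) with used? x
        ... | yes used = inj₂ used
        ... | no unused = inj₁ (tx , adm , unused)

      x : Fin n
      x = proj₁ (select-rank available? (c k) enough)

      x-available : Available x
      x-available = proj₁ (proj₂ (select-rank available? (c k) enough))

      x-rank : ∀ dA → count (λ y → Available y × x < y) dA ≡ c k
      x-rank = proj₂ (proj₂ (select-rank available? (c k) enough))

      h′ : Fin n → Fin n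
      h′ = updateAt h k (const x)

      h′-at-k : h′ k ≡ x
      h′-at-k = updateAt-updates k h

      h′-elsewhere : ∀ {m} → m ≢ k → h′ m ≡ h m
      h′-elsewhere m≢k = updateAt-minimal _ k h m≢k

      admissible′ : ∀ m → S m → toℕ k ℕ.≤ toℕ m → T (h′ m) × Adm (h′ m) m
      admissible′ m sm k≤m = by-cases (m ≟ k)
        where
        by-cases : Dec (m ≡ k) → T (h′ m) × Adm (h′ m) m
        by-cases (yes refl) = subst (λ z → T z × Adm z k) (sym h′-at-k)
                                (proj₁ x-available , proj₁ (proj₂ x-available))
        by-cases (no m≢k) = subst (λ z → T z × Adm z m) (sym (h′-elsewhere m≢k))
                              (admissible m sm (after k≤m m≢k))

      x-unused : ∀ m → S m → k < m → h m ≢ x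
      x-unused m sm k<m hm≡x = proj₂ (proj₂ x-available) (m , (sm , k<m) , hm≡x)

      injective′ : ∀ m m' → S m → S m' → toℕ k ℕ.≤ toℕ m → toℕ k ℕ.≤ toℕ m' → h′ m ≡ h′ m' → m ≡ m'
      injective′ m m' sm sm' k≤m k≤m' h′m≡h′m' = by-cases (m ≟ k) (m' ≟ k)
        where
        by-cases : Dec (m ≡ k) → Dec (m' ≡ k) → m ≡ m'
        by-cases (yes refl) (yes refl) = refl
        by-cases (yes refl) (no m'≢k) = ⊥-elim (x-unused m' sm' (after k≤m' m'≢k)
          (trans (sym (h′-elsewhere m'≢k)) (trans (sym h′m≡h′m') h′-at-k)))
        by-cases (no m≢k) (yes refl) = ⊥-elim (x-unused m sm (after k≤m m≢k)
          (trans (sym (h′-elsewhere m≢k)) (trans h′m≡h′m' h′-at-k)))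
        by-cases (no m≢k) (no m'≢k) = injective m m' sm sm' (after k≤m m≢k) (after k≤m' m'≢k)
          (trans (sym (h′-elsewhere m≢k)) (trans h′m≡h′m' (h′-elsewhere m'≢k)))

      h′-later : ∀ {m} → k < m → h′ m ≡ h m
      h′-later k<m = h′-elsewhere (λ { refl → Finₚ.<-irrefl refl k<m })

      -- The targets free above h′ k = x are the available targets above x.
      rank-at-k : c k ≡ count (Free k h′) (free? k h′)
      rank-at-k = trans (sym (x-rank (λ y → available? y ×-dec (x <? y)))) (count-ext _ _ to from)
        where
        to : ∀ y → Available y × x < y → Free k h′ y
        to y ((ty , _ , unused) , x<y) = ty , subst (_< y) (sym h′-at-k) x<y , not-used
          where
          not-used : ¬ UsedFrom k h′ y
          not-used (m , (sm , k≤m) , h′m≡y) = by-cases (m ≟ k) h′m≡y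
            where
            by-cases : Dec (m ≡ k) → h′ m ≡ y → ⊥
            by-cases (yes refl) h′k≡y = Finₚ.<-irrefl (trans (sym h′-at-k) h′k≡y) x<y
            by-cases (no m≢k) h′m≡y =
              unused (m , (sm , after k≤m m≢k) , trans (sym (h′-elsewhere m≢k)) h′m≡y)
        from : ∀ y → Free k h′ y → Available y × x < y
        from y (ty , h′k<y , not-used) = (ty , adm-up (proj₁ (proj₂ x-available)) x<y , unused) , x<y
          where
          x<y : x < y
          x<y = subst (_< y) h′-at-k h′k<y
          unused : ¬ Used y
          unused (m , (sm , k<m) , hm≡y) = not-used (m , (sm , ℕₚ.<⇒≤ k<m) , trans (h′-later k<m) hm≡y)

      rank-later : ∀ m → S m → k < m → c m ≡ count (Free m h′) (free? m h′)
      rank-later m sm k<m = trans (rank m sm k<m) (count-ext _ _ to from)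
        where
        k<m' : ∀ {m'} → m ≤ m' → k < m'
        k<m' m≤m' = ℕₚ.<-≤-trans k<m m≤m'
        to : ∀ y → Free m h y → Free m h′ y
        to y (ty , hm<y , not-used) = ty , subst (_< y) (sym (h′-later k<m)) hm<y ,
          λ { (m' , (sm' , m≤m') , h′m'≡y) →
                not-used (m' , (sm' , m≤m') , trans (sym (h′-later (k<m' m≤m'))) h′m'≡y) }
        from : ∀ y → Free m h′ y → Free m h y
        from y (ty , h′m<y , not-used) = ty , subst (_< y) (h′-later k<m) h′m<y ,
          λ { (m' , (sm' , m≤m') , hm'≡y) →
                not-used (m' , (sm' , m≤m') , trans (h′-later (k<m' m≤m')) hm'≡y) }

      invariant′ : Invariant (toℕ k) h′
      invariant′ = record
        { admissible = admissible′
        ; injective = injective′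
        ; rank = λ m sm k≤m → by-cases m sm k≤m (m ≟ k) }
        where
        by-cases : ∀ m → S m → toℕ k ℕ.≤ toℕ m → Dec (m ≡ k) → c m ≡ count (Free m h′) (free? m h′)
        by-cases m sm k≤m (yes refl) = rank-at-k
        by-cases m sm k≤m (no m≢k) = rank-later m sm (after k≤m m≢k)

    step : ∀ k → Σ (Fin n → Fin n) (Invariant (suc (toℕ k))) → Σ (Fin n → Fin n) (Invariant (toℕ k))
    step k (h , inv) with S? k
    ... | yes sk = Assign.h′ k h inv sk , Assign.invariant′ k h inv sk
    ... | no ¬sk = h , skip k h ¬sk inv

    -- Matching the sources at positions ≥ j, by recursion on d = n - j.
    build : ∀ d j → d + j ≡ n → Σ (Fin n → Fin n) (Invariant j)
    build zero j refl = (λ i → i) , initial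
    build (suc d) j d+1+j≡n = subst (λ i → Σ (Fin n → Fin n) (Invariant i)) (Finₚ.toℕ-fromℕ< j<n)
        (step k (subst (λ i → Σ (Fin n → Fin n) (Invariant (suc i))) (sym (Finₚ.toℕ-fromℕ< j<n))
                  (build d (suc j) (trans (ℕₚ.+-suc d j) d+1+j≡n))))
      where
      j<n : j ℕ.< n
      j<n = subst (j ℕ.<_) d+1+j≡n (s≤s (ℕₚ.m≤n+m j d))
      k : Fin n
      k = fromℕ< j<n

    -- Only the invariant of the final matching matters, never its computation.
    opaque
      matched : Σ (Fin n → Fin n) (Invariant 0)
      matched = build n 0 (ℕₚ.+-identityʳ n)

    matching : Fin n → Fin n
    matching = proj₁ matched

    open Invariant (proj₂ matched)

    matching-admissible : ∀ k → S k → T (matching k) × Adm (matching k) k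
    matching-admissible k sk = admissible k sk z≤n

    matching-injective : InjectiveOn S matching
    matching-injective m m' sm sm' = injective m m' sm sm' z≤n z≤n

    matching-onto : ∀ y → T y → Img S matching y
    matching-onto = count-onto S? T? matching matching-injective
      (λ m sm → proj₁ (matching-admissible m sm)) |S|≡|T|

    -- Since every target is matched, the targets free above matching k are the
    -- targets of the earlier sources matched above it.
    matching-rank : ∀ k → S k → c k ≡ count (λ m → S m × m < k × matching k < matching m)
                                             (λ m → S? m ×-dec ((m <? k) ×-dec (matching k <? matching m)))
    matching-rank k sk = trans (rank k sk z≤n) (trans (count-ext _ (img? crossing? matching) to from)
      (count-img crossing? matching (λ m m' (sm , _) (sm' , _) → matching-injective m m' sm sm') _))
      where
      Crossing : Fin n → Set
      Crossing m = S m × m < k × matching k < matching m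
      crossing? : Decidable Crossing
      crossing? m = S? m ×-dec ((m <? k) ×-dec (matching k <? matching m))
      to : ∀ y → Free k matching y → Img Crossing matching y
      to y (ty , hk<y , not-used) with matching-onto y ty
      ... | m , sm , hm≡y with k ≤? m
      ...   | yes k≤m = ⊥-elim (not-used (m , (sm , k≤m) , hm≡y))
      ...   | no k≰m = m , (sm , ℕₚ.≰⇒> k≰m , subst (matching k <_) (sym hm≡y) hk<y) , hm≡y
      from : ∀ y → Img Crossing matching y → Free k matching y
      from y (m , (sm , m<k , hk<hm) , hm≡y) = subst T hm≡y (proj₁ (matching-admissible m sm)) ,
        subst (matching k <_) hm≡y hk<hm ,
        λ { (m' , (sm' , k≤m') , hm'≡y) → ℕₚ.<⇒≱ m<k
              (subst (k ≤_) (matching-injective m' m sm' sm (trans hm'≡y (sym hm≡y))) k≤m') }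

  opposite-< : ∀ {n} {i j : Fin n} → i < j → opposite j < opposite i
  opposite-< {n} {i} {j} i<j = subst₂ ℕ._<_ (sym (Finₚ.opposite-prop j)) (sym (Finₚ.opposite-prop i))
    (ℕₚ.∸-monoʳ-< (s≤s i<j) (Finₚ.toℕ<n j))

  opposite-<-reflect : ∀ {n} {i j : Fin n} → opposite j < opposite i → i < j
  opposite-<-reflect {i = i} {j} o<o =
    subst₂ _<_ (Finₚ.opposite-involutive i) (Finₚ.opposite-involutive j) (opposite-< o<o)

  opposite-injective : ∀ {n} {i j : Fin n} → opposite i ≡ opposite j → i ≡ j
  opposite-injective {i = i} {j} e =
    trans (sym (Finₚ.opposite-involutive i)) (trans (cong opposite e) (Finₚ.opposite-involutive j))

  opposite-≤ : ∀ {n} {i j : Fin n} → i ≤ j → opposite j ≤ opposite i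
  opposite-≤ i≤j = ℕₚ.≮⇒≥ (λ o<o → ℕₚ.<⇒≱ (opposite-<-reflect o<o) i≤j)

  opposite-≤-reflect : ∀ {n} {i j : Fin n} → opposite j ≤ opposite i → i ≤ j
  opposite-≤-reflect {i = i} {j} o≤o =
    subst₂ _≤_ (Finₚ.opposite-involutive i) (Finₚ.opposite-involutive j) (opposite-≤ o≤o)

  split-by-bit : ∀ {n} (f : Fin n → Bool) {R : Fin n → Set} (R? : Decidable R) →
    count (λ x → f x ≡ true × R x) (λ x → (f x Bool.≟ true) ×-dec R? x) +
    count (λ x → f x ≡ false × R x) (λ x → (f x Bool.≟ false) ×-dec R? x) ≡ count R R?
  split-by-bit f {R} R? = sym (count-union _ _ R? (λ x (f≡1 , _) (f≡0 , _) → not-¬ f≡1 f≡0)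
    (λ x r → by-bit (f x) refl r) (λ { x (inj₁ (_ , r)) → r ; x (inj₂ (_ , r)) → r }))
    where
    by-bit : ∀ {x} b → f x ≡ b → R x → (f x ≡ true × R x) ⊎ (f x ≡ false × R x)
    by-bit true e r = inj₁ (e , r)
    by-bit false e r = inj₂ (e , r)

  split-at : ∀ {n} {P : Fin n → Set} (P? : Decidable P) (k : Fin n) →
    count (λ x → P x × x ≤ k) (λ x → P? x ×-dec (x ≤? k)) +
    count (λ x → P x × k < x) (λ x → P? x ×-dec (k <? x)) ≡ count P P?
  split-at {P = P} P? k = sym (count-union _ _ P? (λ x (_ , x≤k) (_ , k<x) → ℕₚ.<⇒≱ k<x x≤k)
    (λ x px → by-position x px (x ≤? k)) (λ { x (inj₁ (px , _)) → px ; x (inj₂ (px , _)) → px }))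
    where
    by-position : ∀ x → P x → Dec (x ≤ k) → (P x × x ≤ k) ⊎ (P x × k < x)
    by-position x px (yes x≤k) = inj₁ (px , x≤k)
    by-position x px (no x≰k) = inj₂ (px , ℕₚ.≰⇒> x≰k)

  split-around : ∀ {n} {P : Fin n → Set} (P? : Decidable P) (k : Fin n) → ¬ P k →
    count (λ x → P x × x < k) (λ x → P? x ×-dec (x <? k)) +
    count (λ x → P x × k < x) (λ x → P? x ×-dec (k <? x)) ≡ count P P?
  split-around {P = P} P? k ¬pk = sym (count-union _ _ P? (λ x (_ , x<k) (_ , k<x) → Finₚ.<-asym x<k k<x)
    (λ x px → by-position x px (Finₚ.<-cmp x k)) (λ { x (inj₁ (px , _)) → px ; x (inj₂ (px , _)) → px }))
    where
    by-position : ∀ x → P x → Tri (x < k) (x ≡ k) (k < x) → (P x × x < k) ⊎ (P x × k < x)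
    by-position x px (tri< x<k _ _) = inj₁ (px , x<k)
    by-position x px (tri≈ _ refl _) = ⊥-elim (¬pk px)
    by-position x px (tri> _ _ k<x) = inj₂ (px , k<x)

  -- Existence: under the bound, a permutation realising (v, p, μ) is assembled from
  -- two greedy matchings: excedances k (p k = 1) to values x > k with v x = 1, and
  -- non-excedances k (p k = 0) to values x ≤ k with v x = 0, the latter read from
  -- right to left through opposite.
  module Existence {n : ℕ} (v p : Fin n → Bool) (μ : Fin n → ℕ) (same-zeros : zeros v ≡ zeros p)
    (bound : ∀ k → suc (μ k + zerosBefore p k) ℕ.≤ zerosUpTo v k) where

    ones : (Fin n → Bool) → ℕ
    ones f = count (λ i → f i ≡ true) (λ i → f i Bool.≟ true)

    same-ones : ones p ≡ ones v
    same-ones = ℕₚ.+-cancelˡ-≡ (zeros p) _ _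
      (trans (zeros+ones p) (trans (sym (zeros+ones v)) (cong (_+ ones v) same-zeros)))

    above : (Fin n → Bool) → Bool → Fin n → ℕ
    above f b k = count (λ x → f x ≡ b × k < x) (λ x → (f x Bool.≟ b) ×-dec (k <? x))

    -- At an excedance k there is room for the upper matching: below, above and at k,
    -- the zeros of v and p are balanced, so the bound leaves μ k + (later ones of p)
    -- below the number of ones of v after k.
    room-upper : ∀ k → p k ≡ true → suc (μ k + above p true k) ℕ.≤ above v true k
    room-upper k pk = ℕₚ.+-cancelʳ-≤ (above v false k + zB) _ _ (begin
      suc (μ k + above p true k) + (above v false k + zB)
        ≡⟨ regroup (μ k) (above p true k) (above v false k) zB ⟩
      above p true k + (suc (μ k + zB) + above v false k)
        ≤⟨ ℕₚ.+-monoʳ-≤ (above p true k) (ℕₚ.+-monoˡ-≤ _ (bound k)) ⟩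
      above p true k + (zU + above v false k)
        ≡⟨ cong (above p true k +_) zeros-balance ⟩
      above p true k + (zB + above p false k)
        ≡⟨ regroup′ (above p true k) zB (above p false k) ⟩
      (above p true k + above p false k) + zB
        ≡⟨ cong (_+ zB) (trans (split-by-bit p (k <?_)) (sym (split-by-bit v (k <?_)))) ⟩
      (above v true k + above v false k) + zB
        ≡⟨ ℕₚ.+-assoc (above v true k) _ _ ⟩
      above v true k + (above v false k + zB) ∎)
      where
      open ℕₚ.≤-Reasoning
      zU = zerosUpTo v k
      zB = zerosBefore p k
      regroup : ∀ a b c d → suc (a + b) + (c + d) ≡ b + (suc (a + d) + c)
      regroup = solve-∀
      regroup′ : ∀ b d e → b + (d + e) ≡ (b + e) + d
      regroup′ = solve-∀
      zeros-balance : zU + above v false k ≡ zB + above p false k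
      zeros-balance = trans (split-at (λ x → v x Bool.≟ false) k)
        (trans same-zeros (sym (split-around (λ x → p x Bool.≟ false) k (not-¬ pk))))

    module Upper = GreedyMatching (λ k → p k ≡ true) (λ x → v x ≡ true)
      (λ k → p k Bool.≟ true) (λ x → v x Bool.≟ true)
      (λ x k → k < x) (λ x k → k <? x) Finₚ.<-trans μ same-ones
      room-upper

    -- The non-excedances, read from right to left: position k′ stands for opposite k′.
    ZeroOfP ZeroOfV : Fin n → Set
    ZeroOfP k′ = p (opposite k′) ≡ false
    ZeroOfV x′ = v (opposite x′) ≡ false

    zeroOfP? : Decidable ZeroOfP
    zeroOfP? k′ = p (opposite k′) Bool.≟ false

    zeroOfV? : Decidable ZeroOfV
    zeroOfV? x′ = v (opposite x′) Bool.≟ false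

    count-opposite : ∀ {P Q : Fin n → Set} (P? : Decidable P) (Q? : Decidable Q) →
      (∀ x → Q x → P (opposite x)) → (∀ x → P (opposite x) → Q x) → count Q Q? ≡ count P P?
    count-opposite P? Q? = count-bij Q? P? opposite opposite Finₚ.opposite-involutive Finₚ.opposite-involutive

    same-reversed-zeros : count ZeroOfP zeroOfP? ≡ count ZeroOfV zeroOfV?
    same-reversed-zeros = trans (count-opposite _ zeroOfP? (λ _ e → e) (λ _ e → e))
      (trans (sym same-zeros) (sym (count-opposite _ zeroOfV? (λ _ e → e) (λ _ e → e))))

    -- After reversal, the bound at opposite k′ is exactly the room the greedy matching needs.
    room-lower : ∀ k′ → ZeroOfP k′ →
      suc (μ (opposite k′) + count (λ m′ → ZeroOfP m′ × k′ < m′) (λ m′ → zeroOfP? m′ ×-dec (k′ <? m′)))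
        ℕ.≤ count (λ x′ → ZeroOfV x′ × k′ ≤ x′) (λ x′ → zeroOfV? x′ ×-dec (k′ ≤? x′))
    room-lower k′ _ = subst₂ (λ b u → suc (μ (opposite k′) + b) ℕ.≤ u)
      (sym (count-opposite _ _ (λ _ (p≡0 , k′<m′) → p≡0 , opposite-< k′<m′)
                               (λ _ (p≡0 , om′<ok′) → p≡0 , opposite-<-reflect om′<ok′)))
      (sym (count-opposite _ _ (λ _ (v≡0 , k′≤x′) → v≡0 , opposite-≤ k′≤x′)
                               (λ _ (v≡0 , ox′≤ok′) → v≡0 , opposite-≤-reflect ox′≤ok′)))
      (bound (opposite k′))

    module Lower = GreedyMatching ZeroOfP ZeroOfV zeroOfP? zeroOfV?
      (λ x′ k′ → k′ ≤ x′) (λ x′ k′ → k′ ≤? x′)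
      (λ k′≤x′ x′<y′ → ℕₚ.≤-trans k′≤x′ (ℕₚ.<⇒≤ x′<y′)) (μ ∘ opposite) same-reversed-zeros room-lower

    up low : Fin n → Fin n
    up = Upper.matching
    low k = opposite (Lower.matching (opposite k))

    up-spec : ∀ k → p k ≡ true → v (up k) ≡ true × k < up k
    up-spec = Upper.matching-admissible

    zeroOfP-opposite : ∀ {k} → p k ≡ false → ZeroOfP (opposite k)
    zeroOfP-opposite {k} pk = subst (λ i → p i ≡ false) (sym (Finₚ.opposite-involutive k)) pk

    low-spec : ∀ k → p k ≡ false → v (low k) ≡ false × low k ≤ k
    low-spec k pk with Lower.matching-admissible (opposite k) (zeroOfP-opposite pk)
    ... | v≡0 , ok≤L = v≡0 , subst (low k ≤_) (Finₚ.opposite-involutive k) (opposite-≤ ok≤L)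

    low-injective : InjectiveOn (λ k → p k ≡ false) low
    low-injective k k′ pk pk′ low≡low = opposite-injective
      (Lower.matching-injective _ _ (zeroOfP-opposite pk) (zeroOfP-opposite pk′) (opposite-injective low≡low))

    low-rank : ∀ k → p k ≡ false →
      μ k ≡ count (λ m → p m ≡ false × k < m × low m < low k)
                  (λ m → (p m Bool.≟ false) ×-dec ((k <? m) ×-dec (low m <? low k)))
    low-rank k pk = trans (cong μ (sym (ō∘ō k)))
      (trans (Lower.matching-rank (opposite k) (zeroOfP-opposite pk)) (count-opposite _ _ to from))
      where
      ō∘ō : ∀ (i : Fin n) → opposite (opposite i) ≡ i
      ō∘ō = Finₚ.opposite-involutive
      L : Fin n → Fin n
      L = Lower.matching
      to : ∀ m′ → ZeroOfP m′ × m′ < opposite k × L (opposite k) < L m′ →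
           p (opposite m′) ≡ false × k < opposite m′ × low (opposite m′) < low k
      to m′ (p≡0 , m′<ok , Lk<Lm′) = p≡0 , subst (_< opposite m′) (ō∘ō k) (opposite-< m′<ok) ,
        subst (λ z → opposite (L z) < low k) (sym (ō∘ō m′)) (opposite-< Lk<Lm′)
      from : ∀ m′ → p (opposite m′) ≡ false × k < opposite m′ × low (opposite m′) < low k →
             ZeroOfP m′ × m′ < opposite k × L (opposite k) < L m′
      from m′ (p≡0 , k<om′ , low<low) = p≡0 , opposite-<-reflect (subst (_< opposite m′) (sym (ō∘ō k)) k<om′) ,
        opposite-<-reflect (subst (λ z → opposite (L z) < low k) (ō∘ō m′) low<low)

    σ-map : Fin n → Fin n
    σ-map k = if p k then up k else low k

    σ-map-at-up : ∀ k → p k ≡ true → σ-map k ≡ up k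
    σ-map-at-up k pk = cong (λ b → if b then up k else low k) pk

    σ-map-at-low : ∀ k → p k ≡ false → σ-map k ≡ low k
    σ-map-at-low k pk = cong (λ b → if b then up k else low k) pk

    σ-map-up : ∀ k → p k ≡ true → v (σ-map k) ≡ true × k < σ-map k
    σ-map-up k pk = subst (λ y → v y ≡ true × k < y) (sym (σ-map-at-up k pk)) (up-spec k pk)

    σ-map-low : ∀ k → p k ≡ false → v (σ-map k) ≡ false × σ-map k ≤ k
    σ-map-low k pk = subst (λ y → v y ≡ false × y ≤ k) (sym (σ-map-at-low k pk)) (low-spec k pk)

    -- Excedances and non-excedances are sent to values with v = 1 and v = 0 respectively,
    -- so injectivity reduces to that of each matching.
    σ-map-injective : ∀ i j → σ-map i ≡ σ-map j → i ≡ j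
    σ-map-injective i j = by-bits (p i) (p j) refl refl
      where
      by-bits : ∀ b c → p i ≡ b → p j ≡ c → σ-map i ≡ σ-map j → i ≡ j
      by-bits true true pi pj e = Upper.matching-injective i j pi pj
        (trans (sym (σ-map-at-up i pi)) (trans e (σ-map-at-up j pj)))
      by-bits false false pi pj e = low-injective i j pi pj
        (trans (sym (σ-map-at-low i pi)) (trans e (σ-map-at-low j pj)))
      by-bits true false pi pj e =
        ⊥-elim (not-¬ (proj₁ (σ-map-up i pi)) (trans (cong v e) (proj₁ (σ-map-low j pj))))
      by-bits false true pi pj e =
        ⊥-elim (not-¬ (proj₁ (σ-map-up j pj)) (trans (cong v (sym e)) (proj₁ (σ-map-low i pi))))

    -- Being injective on a finite set, σ-map is onto; the preimages it yields are
    -- only ever used through this property.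
    opaque
      σ-map-onto : ∀ y → Img (λ _ → ⊤) σ-map y
      σ-map-onto y = count-onto (λ _ → yes tt) (λ _ → yes tt) σ-map (λ i j _ _ → σ-map-injective i j)
        (λ _ _ → tt) refl y tt

    σ : Permutation′ n
    σ = permutation σ-map (λ y → proj₁ (σ-map-onto y)) (λ y → proj₂ (proj₂ (σ-map-onto y)))
      (λ x → σ-map-injective _ _ (proj₂ (proj₂ (σ-map-onto (σ-map x)))))

    open PermutationFacts σ using (σʳ; σˡ; σʳ∘σˡ; ⇒pos-true; ⇒pos-false; ⇒val-true; ⇒val-false;
                                  nest-up-positions; nest-low-positions)

    realises-pos : ∀ i → pos σ i ≡ p i
    realises-pos i = by-bit (p i) refl
      where
      by-bit : ∀ b → p i ≡ b → pos σ i ≡ p i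
      by-bit true pi = trans (⇒pos-true i (proj₂ (σ-map-up i pi))) (sym pi)
      by-bit false pi = trans (⇒pos-false i (proj₂ (σ-map-low i pi))) (sym pi)

    realises-val : ∀ ℓ → val σ ℓ ≡ v ℓ
    realises-val ℓ = by-bit (p (σˡ ℓ)) refl
      where
      v-at : ∀ {b} → v (σʳ (σˡ ℓ)) ≡ b → v ℓ ≡ b
      v-at = trans (cong v (sym (σʳ∘σˡ ℓ)))
      by-bit : ∀ b → p (σˡ ℓ) ≡ b → val σ ℓ ≡ v ℓ
      by-bit true pk = trans (⇒val-true ℓ (subst (σˡ ℓ <_) (σʳ∘σˡ ℓ) (proj₂ (σ-map-up _ pk))))
                             (sym (v-at (proj₁ (σ-map-up _ pk))))
      by-bit false pk = trans (⇒val-false ℓ (subst (_≤ σˡ ℓ) (σʳ∘σˡ ℓ) (proj₂ (σ-map-low _ pk))))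
                              (sym (v-at (proj₁ (σ-map-low _ pk))))

    -- At an excedance, the positions nesting k are the earlier excedances matched above k.
    realises-nest-up : ∀ k → p k ≡ true → nest σ k ≡ μ k
    realises-nest-up k pk = trans (nest-up-positions k k<σk (λ m → (m <? k) ×-dec (σʳ k <? σʳ m)))
      (sym (trans (Upper.matching-rank k pk) (count-ext _ _ to from)))
      where
      k<σk : k < σʳ k
      k<σk = proj₂ (σ-map-up k pk)
      to : ∀ m → p m ≡ true × m < k × up k < up m → m < k × σʳ k < σʳ m
      to m (pm , m<k , upk<upm) = m<k , subst₂ _<_ (sym (σ-map-at-up k pk)) (sym (σ-map-at-up m pm)) upk<upm
      from : ∀ m → m < k × σʳ k < σʳ m → p m ≡ true × m < k × up k < up m
      from m (m<k , σk<σm) = by-bit (p m) refl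
        where
        by-bit : ∀ b → p m ≡ b → p m ≡ true × m < k × up k < up m
        by-bit true pm = pm , m<k , subst₂ _<_ (σ-map-at-up k pk) (σ-map-at-up m pm) σk<σm
        by-bit false pm =
          ⊥-elim (ℕₚ.<-asym (Finₚ.<-trans k<σk σk<σm) (ℕₚ.≤-<-trans (proj₂ (σ-map-low m pm)) m<k))

    -- At a non-excedance, the positions nesting k are the later non-excedances matched below k.
    realises-nest-low : ∀ k → p k ≡ false → nest σ k ≡ μ k
    realises-nest-low k pk = trans (nest-low-positions k σk≤k (λ m → (k <? m) ×-dec (σʳ m <? σʳ k)))
      (sym (trans (low-rank k pk) (count-ext _ _ to from)))
      where
      σk≤k : σʳ k ≤ k
      σk≤k = proj₂ (σ-map-low k pk)
      to : ∀ m → p m ≡ false × k < m × low m < low k → k < m × σʳ m < σʳ k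
      to m (pm , k<m , lowm<lowk) =
        k<m , subst₂ _<_ (sym (σ-map-at-low m pm)) (sym (σ-map-at-low k pk)) lowm<lowk
      from : ∀ m → k < m × σʳ m < σʳ k → p m ≡ false × k < m × low m < low k
      from m (k<m , σm<σk) = by-bit (p m) refl
        where
        by-bit : ∀ b → p m ≡ b → p m ≡ false × k < m × low m < low k
        by-bit false pm = pm , k<m , subst₂ _<_ (σ-map-at-low m pm) (σ-map-at-low k pk) σm<σk
        by-bit true pm =
          ⊥-elim (ℕₚ.<-asym (Finₚ.<-trans k<m (proj₂ (σ-map-up m pm))) (ℕₚ.<-≤-trans σm<σk σk≤k))

    realises-nest : ∀ k → nest σ k ≡ μ k
    realises-nest k = by-bit (p k) refl
      where
      by-bit : ∀ b → p k ≡ b → nest σ k ≡ μ k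
      by-bit true = realises-nest-up k
      by-bit false = realises-nest-low k

  zerosUpTo-cong : ∀ {n} {f g : Fin n → Bool} → (∀ i → f i ≡ g i) → ∀ k → zerosUpTo f k ≡ zerosUpTo g k
  zerosUpTo-cong {f = f} {g} f≗g k =
    count-ext (λ ℓ → (f ℓ Bool.≟ false) ×-dec (ℓ ≤? k)) (λ ℓ → (g ℓ Bool.≟ false) ×-dec (ℓ ≤? k))
    (λ ℓ (e , ℓ≤k) → trans (sym (f≗g ℓ)) e , ℓ≤k) (λ ℓ (e , ℓ≤k) → trans (f≗g ℓ) e , ℓ≤k)

  zerosBefore-cong : ∀ {n} {f g : Fin n → Bool} → (∀ i → f i ≡ g i) → ∀ k → zerosBefore f k ≡ zerosBefore g k
  zerosBefore-cong {f = f} {g} f≗g k =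
    count-ext (λ ℓ → (f ℓ Bool.≟ false) ×-dec (ℓ <? k)) (λ ℓ → (g ℓ Bool.≟ false) ×-dec (ℓ <? k))
    (λ ℓ (e , ℓ<k) → trans (sym (f≗g ℓ)) e , ℓ<k) (λ ℓ (e , ℓ<k) → trans (f≗g ℓ) e , ℓ<k)

  realised⇒bound : ∀ {n} {v p : Fin n → Bool} {μ : Fin n → ℕ} (σ : Permutation′ n) → Realises v p μ σ →
    ∀ k → suc (μ k ℕ.+ zerosBefore p k) ℕ.≤ zerosUpTo v k
  realised⇒bound {v = v} σ (σ-val , σ-pos , σ-nest) k =
    subst₂ (λ a b → suc (a ℕ.+ b) ℕ.≤ zerosUpTo v k) (σ-nest k) (zerosBefore-cong σ-pos k)
      (subst (suc (nest σ k ℕ.+ zerosBefore (pos σ) k) ℕ.≤_) (zerosUpTo-cong σ-val k)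
        (PermutationFacts.nest-bound σ k))

  bound⇒uniquely-realised : ∀ {n} (v p : Fin n → Bool) (μ : Fin n → ℕ) → zeros v ≡ zeros p →
    (∀ k → suc (μ k ℕ.+ zerosBefore p k) ℕ.≤ zerosUpTo v k) → UniqueRealising v p μ
  bound⇒uniquely-realised {n} v p μ same-zeros bound =
    σ , (realises-val , realises-pos , realises-nest) , unique
    where
    open Existence v p μ same-zeros bound using (σ; realises-val; realises-pos; realises-nest)
    unique : (τ : Permutation′ n) → Realises v p μ τ → ∀ i → τ ⟨$⟩ʳ i ≡ σ ⟨$⟩ʳ i
    unique τ (τ-val , τ-pos , τ-nest) = realisation-unique τ σ
      (λ i → trans (τ-val i) (sym (realises-val i))) (λ i → trans (τ-pos i) (sym (realises-pos i)))
      (λ i → trans (τ-nest i) (sym (realises-nest i)))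

open import Defs
open import Data.Nat using (ℕ)
import Data.Nat as N
open import Data.Bool using (Bool)
open import Data.Fin using (Fin)
open import Data.Integer using (ℤ; +_; _-_; _≤_; 1ℤ; _+_; -_; +≤+)
import Data.Integer.Properties as ℤₚ
open import Data.Integer.Tactic.RingSolver using (solve-∀)
open import Data.Product using (_×_; _,_; proj₂)
open import Function.Bundles using (_⇔_; mk⇔)
open import Relation.Binary.PropositionalEquality using (_≡_; trans; cong)
open ValPosNes using (realised⇒bound; bound⇒uniquely-realised)

-- The bound of the theorem, stated over ℤ, is μ k + zerosBefore p k < zerosUpTo v k over ℕ.
module IntegerBound (m a b : ℕ) where
  open ℤₚ.≤-Reasoning

  lift : + N.suc (m N.+ b) ≡ 1ℤ + (+ m + + b)
  lift = trans (ℤₚ.pos-+ 1 (m N.+ b)) (cong (λ z → 1ℤ + z) (ℤₚ.pos-+ m b))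

  shift : ∀ (x y : ℤ) → 1ℤ + (x + y) ≡ x + (1ℤ + y)
  shift = solve-∀

  cancel : ∀ (x y : ℤ) → (x - y - 1ℤ) + (1ℤ + y) ≡ x
  cancel = solve-∀

  unshift : ∀ (x y : ℤ) → x ≡ (1ℤ + (x + y)) - (1ℤ + y)
  unshift = solve-∀

  regroup : ∀ (x y : ℤ) → x - (1ℤ + y) ≡ x - y - 1ℤ
  regroup = solve-∀

  from-ℤ : + m ≤ + a - + b - 1ℤ → N.suc (m N.+ b) N.≤ a
  from-ℤ m≤a-b-1 = ℤₚ.drop‿+≤+ (begin
    + N.suc (m N.+ b)              ≡⟨ trans lift (shift (+ m) (+ b)) ⟩
    + m + (1ℤ + + b)               ≤⟨ ℤₚ.+-monoˡ-≤ (1ℤ + + b) m≤a-b-1 ⟩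
    (+ a - + b - 1ℤ) + (1ℤ + + b)  ≡⟨ cancel (+ a) (+ b) ⟩
    + a                            ∎)

  to-ℤ : N.suc (m N.+ b) N.≤ a → + m ≤ + a - + b - 1ℤ
  to-ℤ m+b<a = begin
    + m                             ≡⟨ unshift (+ m) (+ b) ⟩
    (1ℤ + (+ m + + b)) - (1ℤ + + b)  ≡⟨ cong (_- (1ℤ + + b)) lift ⟨
    + N.suc (m N.+ b) - (1ℤ + + b)   ≤⟨ ℤₚ.+-monoˡ-≤ (- (1ℤ + + b)) (+≤+ m+b<a) ⟩
    + a - (1ℤ + + b)                 ≡⟨ regroup (+ a) (+ b) ⟩
    + a - + b - 1ℤ                   ∎

lemma6 : (n : ℕ) → 1 N.≤ n → (v p : Fin n → Bool) (μ : Fin n → ℕ) →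
    zeros v ≡ zeros p →
    UniqueRealising v p μ ⇔
      (∀ (k : Fin n) → (+ 0 ≤ + μ k) × (+ μ k ≤ (+ zerosUpTo v k) - (+ zerosBefore p k) - 1ℤ))
lemma6 n _ v p μ same-zeros = mk⇔
  (λ (σ , realises , _) k → +≤+ N.z≤n , IntegerBound.to-ℤ (μ k) _ _ (realised⇒bound σ realises k))
  (λ bounds → bound⇒uniquely-realised v p μ same-zeros
    (λ k → IntegerBound.from-ℤ (μ k) _ _ (proj₂ (bounds k))))
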